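{- Let $N=p^{2k}$ with $p>3$ prime and $k\ge1$, let $D\in\mathbb{Z}_N$ and $C\in\mathbb{Z}_{p^k}$ with $p\nmid C$ and $p\nmid D$. Then $\dim_{\mathbb{C}}V_C=p^k-\left(\frac{D}{p}\right)p^{k-1}$, where $\left(\frac{D}{p}\right)$ is the Legendre symbol.
   Context: $e(x)=e^{2\pi ix}$; $\delta_y$ is the indicator of $\{y\}\subseteq\mathbb{Z}_N$; for $x=(x_1,x_2)\in\mathbb{Z}^2$, $\zeta_x=\sum_{t\in\mathbb{Z}_{p^k}}e(x_1t/p^k)\delta_{x_2+p^kt}\in L^2(\mathbb{Z}_N)$ (the line $\mathbb{C}\zeta_x$ depends only on $x\bmod p^k$). $\mathscr{N}:\mathbb{Z}_{p^k}^2\to\mathbb{Z}_{p^k}$, $\mathscr{N}(x)=x_1^2-Dx_2^2$. $V_C=\bigoplus_{x\in\mathbb{Z}_{p^k}^2,\ \mathscr{N}(x)=-C}\mathbb{C}\zeta_x$. -}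

module Defs where

open import Data.Nat using (ℕ; zero; suc; _+_; _*_; _%_; _≡ᵇ_)
open import Data.Nat.Properties using (_≟_)
open import Data.Product using (_×_; _,_)
open import Data.List using (List; length; filter; cartesianProduct; upTo)
open import Data.Bool.ListAction using (any)
open import Data.Bool using (if_then_else_)
open import Data.Integer using (ℤ; +_; -_)

-- residue of a modulo m (m = 0 is never used with m = 0 in the theorem)
_mod_ : ℕ → ℕ → ℕ
a mod zero = a
a mod suc m = a % suc m

pairs : ℕ → List (ℕ × ℕ)
pairs M = cartesianProduct (upTo M) (upTo M)

-- 𝒩(x) = x1^2 - D x2^2 = -C in Z_M, written as x1^2 + C ≡ D x2^2 (mod M)
normEqM : ℕ → ℕ → ℕ → ℕ × ℕ → ℕ × ℕ
normEqM M D C (x1 , x2) = ((x1 * x1 + C) mod M , (D * x2 * x2) mod M)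

-- the index set {x ∈ Z_M^2 : 𝒩(x) = -C}; V_C = ⊕ over it of ℂ ζ_x
indexSet : ℕ → ℕ → ℕ → List (ℕ × ℕ)
indexSet M D C = filter (λ x → let (a , b) = normEqM M D C x in a ≟ b) (pairs M)

dimV : ℕ → ℕ → ℕ → ℕ
dimV M D C = length (indexSet M D C)

legendre : ℕ → ℕ → ℤ
legendre a p =
  if (a mod p) ≡ᵇ 0 then + 0
  else if any (λ y → ((y * y) mod p) ≡ᵇ (a mod p)) (upTo p) then + 1
  else - (+ 1)

-- Since p ∤ C, a solution modulo m (with p ∣ m) has x or y prime to p, so among its p² lifts
-- (x + m s , y + m t) modulo p m the solutions form the zero set of a nonconstant linear form in
-- (s , t): exactly p of them (Hensel). Hence the count modulo p^k is p^(k-1) times the count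
-- modulo p. Modulo p, with χ u = #√ u - 1 where #√ u counts the square roots of u, the count is
-- ∑_y #√ y · #√ (D y - C) = p + ∑_y χ y · χ (D y - C). The character χ is multiplicative, so the
-- last sum is χ D times its value for D = 1; for D = 1 the conic is the hyperbola
-- (x - y) (x + y) = -C with p - 1 points, so the sum is -χ D and the count is p - χ D.
module Submission where

open import Defs
open import Data.Nat using (ℕ; _^_; _<_; _≤_; _∸_)
open import Data.Nat.Divisibility using (_∣_)
open import Data.Nat.Primality using (Prime)
open import Data.Integer using (ℤ; +_; _-_; _*_)
open import Relation.Nullary using (¬_)
open import Relation.Binary.PropositionalEquality using (_≡_)

open import Data.Nat as ℕ using (zero; suc; NonZero; z≤n; s≤s; _%_; _≡ᵇ_)
import Data.Nat.Properties as ℕ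
import Data.Nat.Divisibility as ℕ
open import Data.Nat.DivMod using (m%n<n)
open import Data.Nat.Primality using (euclidsLemma; prime⇒irreducible; prime⇒nonZero; prime⇒nonTrivial)
open import Data.Nat.Coprimality using (Coprime; coprime-Bézout)
open import Data.Nat.GCD using (module Bézout)
open import Data.Integer using (-_; _+_; -[1+_]; +≤+; -≤+) renaming (_≤_ to _≤ℤ_; ∣_∣ to abs)
import Data.Integer.Properties as ℤ
open import Data.Integer.Divisibility.Signed
  using ( divides; ∣ᵤ⇒∣; ∣⇒∣ᵤ; ∣-refl; ∣-trans; ∣m∣n⇒∣m+n; ∣m∣n⇒∣m-n; ∣n⇒∣m*n; ∣m⇒∣m*n; ∣m⇒∣-m
        ; *-monoˡ-∣; *-cancelʳ-∣)
  renaming (_∣_ to _∣ℤ_; _∣?_ to _∣ℤ?_)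
open import Data.Integer.DivMod using (_%ℕ_; _/ℕ_; a≡a%ℕn+[a/ℕn]*n; n%ℕd<d)
open import Data.Integer.Tactic.RingSolver using (solve-∀)
open import Algebra.Properties.AbelianGroup ℤ.+-0-abelianGroup using () renaming (∙-cancelˡ to +-cancelˡ)
open import Data.Bool using (true; false; T)
open import Data.Bool.ListAction using (any)
open import Data.List using (List; []; _∷_; _++_; map; length; filter; cartesianProduct; applyUpTo; upTo)
open import Data.List.Relation.Unary.Any.Properties using (any⁺; any⁻; applyUpTo⁺; applyUpTo⁻)
open import Data.Product using (∃; Σ-syntax; _×_; _,_; proj₂)
open import Data.Sum using (_⊎_; inj₁; inj₂; [_,_]; fromInj₂)
open import Function using (_∘_; _⇔_; mk⇔; Equivalence)
open import Relation.Nullary using (Dec; yes; no; contradiction)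
open import Relation.Unary using (Decidable)
open import Relation.Binary.PropositionalEquality
  using (refl; sym; trans; cong; cong₂; subst; subst₂; _≢_; module ≡-Reasoning)

𝟙 : {P : Set} → Dec P → ℤ
𝟙 (yes _) = + 1
𝟙 (no _) = + 0

𝟙-yes : {P : Set} (P? : Dec P) → P → 𝟙 P? ≡ + 1
𝟙-yes (yes _) _ = refl
𝟙-yes (no ¬p) p = contradiction p ¬p

𝟙-no : {P : Set} (P? : Dec P) → ¬ P → 𝟙 P? ≡ + 0
𝟙-no (yes p) ¬p = contradiction p ¬p
𝟙-no (no _) _ = refl

𝟙-cong : {P Q : Set} (P? : Dec P) (Q? : Dec Q) → (P → Q) → (Q → P) → 𝟙 P? ≡ 𝟙 Q?
𝟙-cong (yes p) Q? f g = sym (𝟙-yes Q? (f p))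
𝟙-cong (no ¬p) Q? f g = sym (𝟙-no Q? (¬p ∘ g))

-- Opaque, so that unification compares the arguments of [ m ∣ z ] instead of unfolding the decision procedure.
opaque
  [_∣_] : ℕ → ℤ → ℤ
  [ m ∣ z ] = 𝟙 (+ m ∣ℤ? z)

  [∣]-yes : ∀ {m z} → + m ∣ℤ z → [ m ∣ z ] ≡ + 1
  [∣]-yes {m} {z} = 𝟙-yes (+ m ∣ℤ? z)

  [∣]-no : ∀ {m z} → ¬ + m ∣ℤ z → [ m ∣ z ] ≡ + 0
  [∣]-no {m} {z} = 𝟙-no (+ m ∣ℤ? z)

  [∣]-cong : ∀ {m n x y} → (+ m ∣ℤ x → + n ∣ℤ y) → (+ n ∣ℤ y → + m ∣ℤ x) → [ m ∣ x ] ≡ [ n ∣ y ]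
  [∣]-cong {m} {n} {x} {y} = 𝟙-cong (+ m ∣ℤ? x) (+ n ∣ℤ? y)

∣-linear : ∀ {k a x y} b c → a ≡ b * x + c * y → k ∣ℤ x → k ∣ℤ y → k ∣ℤ a
∣-linear b c refl k∣x k∣y = ∣m∣n⇒∣m+n (∣n⇒∣m*n b k∣x) (∣n⇒∣m*n c k∣y)

residue : ∀ m .{{_ : NonZero m}} z → Σ[ r ∈ ℕ ] (r < m × + m ∣ℤ z - + r)
residue m z = z %ℕ m , n%ℕd<d z m , divides (z /ℕ m) (begin
  z - + (z %ℕ m)                          ≡⟨ cong (_- + (z %ℕ m)) (a≡a%ℕn+[a/ℕn]*n z m) ⟩
  + (z %ℕ m) + z /ℕ m * + m - + (z %ℕ m)  ≡⟨ cancel (+ (z %ℕ m)) (z /ℕ m * + m) ⟩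
  z /ℕ m * + m                            ∎)
  where
  open ≡-Reasoning
  cancel : ∀ r q → r + q - r ≡ q
  cancel = solve-∀

residue-unique : ∀ {m r s} → r < m → s < m → + m ∣ℤ + r - + s → r ≡ s
residue-unique {m} {r} {s} r<m s<m m∣r-s =
  ℤ.+-injective (ℤ.i-j≡0⇒i≡j (+ r) (+ s) (ℤ.∣i∣≡0⇒i≡0 ∣r-s∣≡0))
  where
  ∣r-s∣<m : abs (+ r - + s) < m
  ∣r-s∣<m = ℕ.≤-<-trans (subst (ℕ._≤ r ℕ.⊔ s) (cong abs (sym (ℤ.m-n≡m⊖n r s))) (ℤ.∣m⊝n∣≤m⊔n r s))
                        (ℕ.⊔-lub r<m s<m)
  ∣r-s∣≡0 : abs (+ r - + s) ≡ 0
  ∣r-s∣≡0 with abs (+ r - + s) in eq | ∣⇒∣ᵤ m∣r-s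
  ... | zero  | _     = refl
  ... | suc n | m∣r-s = contradiction m∣r-s (ℕ.>⇒∤ (subst (_< m) eq ∣r-s∣<m))

∑< : ℕ → (ℕ → ℤ) → ℤ
∑< zero    f = + 0
∑< (suc n) f = f 0 + ∑< n (f ∘ suc)

syntax ∑< n (λ i → e) = ∑[ i < n ] e

∑-cong : ∀ n {f g : ℕ → ℤ} → (∀ i → i < n → f i ≡ g i) → ∑< n f ≡ ∑< n g
∑-cong zero    f≡g = refl
∑-cong (suc n) f≡g = cong₂ _+_ (f≡g 0 (s≤s z≤n)) (∑-cong n (λ i i<n → f≡g (suc i) (s≤s i<n)))

∑-distrib-+ : ∀ n (f g : ℕ → ℤ) → ∑[ i < n ] (f i + g i) ≡ ∑< n f + ∑< n g
∑-distrib-+ zero    f g = refl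
∑-distrib-+ (suc n) f g = trans (cong (_+_ (f 0 + g 0)) (∑-distrib-+ n (f ∘ suc) (g ∘ suc))) (interchange (f 0) (g 0) _ _)
  where
  interchange : ∀ a b c d → a + b + (c + d) ≡ a + c + (b + d)
  interchange = solve-∀

∑-distrib-- : ∀ n (f g : ℕ → ℤ) → ∑[ i < n ] (f i - g i) ≡ ∑< n f - ∑< n g
∑-distrib-- zero    f g = refl
∑-distrib-- (suc n) f g = trans (cong (_+_ (f 0 - g 0)) (∑-distrib-- n (f ∘ suc) (g ∘ suc))) (interchange (f 0) (g 0) _ _)
  where
  interchange : ∀ a b c d → a - b + (c - d) ≡ a + c - (b + d)
  interchange = solve-∀

*-distribˡ-∑ : ∀ n c (f : ℕ → ℤ) → c * ∑< n f ≡ ∑[ i < n ] (c * f i)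
*-distribˡ-∑ zero    c f = ℤ.*-zeroʳ c
*-distribˡ-∑ (suc n) c f = trans (ℤ.*-distribˡ-+ c (f 0) _) (cong (_+_ (c * f 0)) (*-distribˡ-∑ n c (f ∘ suc)))

*-distribʳ-∑ : ∀ n c (f : ℕ → ℤ) → ∑< n f * c ≡ ∑[ i < n ] (f i * c)
*-distribʳ-∑ n c f = trans (ℤ.*-comm (∑< n f) c)
  (trans (*-distribˡ-∑ n c f) (∑-cong n (λ i _ → ℤ.*-comm c (f i))))

∑-const : ∀ n c → ∑[ i < n ] c ≡ + n * c
∑-const zero    c = refl
∑-const (suc n) c = trans (cong (_+_ c) (∑-const n c)) (sym (ℤ.suc-* (+ n) c))

∑-zero : ∀ n {f : ℕ → ℤ} → (∀ i → i < n → f i ≡ + 0) → ∑< n f ≡ + 0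
∑-zero n f≡0 = trans (∑-cong n f≡0) (trans (∑-const n (+ 0)) (ℤ.*-zeroʳ (+ n)))

∑-comm : ∀ n m (f : ℕ → ℕ → ℤ) → ∑[ i < n ] ∑[ j < m ] f i j ≡ ∑[ j < m ] ∑[ i < n ] f i j
∑-comm zero    m f = sym (∑-zero m (λ _ _ → refl))
∑-comm (suc n) m f = trans (cong (_+_ (∑< m (f 0))) (∑-comm n m (f ∘ suc)))
                           (sym (∑-distrib-+ m (f 0) (λ j → ∑[ i < n ] f (suc i) j)))

∑-single : ∀ n {f : ℕ → ℤ} c → c < n → (∀ i → i < n → i ≢ c → f i ≡ + 0) → ∑< n f ≡ f c
∑-single (suc n) {f} zero    _         others = trans (cong (_+_ (f 0)) (∑-zero n (λ i i<n → others (suc i) (s≤s i<n) λ ())))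
                                                     (ℤ.+-identityʳ (f 0))
∑-single (suc n) {f} (suc c) (s≤s c<n) others = trans (cong₂ _+_ (others 0 (s≤s z≤n) λ ()) (∑-single n c c<n others′))
                                                     (ℤ.+-identityˡ _)
  where
  others′ : ∀ i → i < n → i ≢ c → f (suc i) ≡ + 0
  others′ i i<n i≢c = others (suc i) (s≤s i<n) (i≢c ∘ ℕ.suc-injective)

∑-split : ∀ m n (f : ℕ → ℤ) → ∑< (m ℕ.+ n) f ≡ ∑< m f + ∑[ i < n ] f (m ℕ.+ i)
∑-split zero    n f = sym (ℤ.+-identityˡ _)
∑-split (suc m) n f = trans (cong (_+_ (f 0)) (∑-split m n (f ∘ suc))) (sym (ℤ.+-assoc (f 0) _ _))

∑-blocks : ∀ n m (f : ℕ → ℤ) → ∑< (n ℕ.* m) f ≡ ∑[ r < m ] ∑[ s < n ] f (r ℕ.+ m ℕ.* s)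
∑-blocks zero    m f = sym (∑-zero m (λ _ _ → refl))
∑-blocks (suc n) m f = begin
  ∑< (m ℕ.+ n ℕ.* m) f
    ≡⟨ ∑-split m (n ℕ.* m) f ⟩
  ∑< m f + ∑[ i < n ℕ.* m ] f (m ℕ.+ i)
    ≡⟨ cong (_+_ (∑< m f)) (∑-blocks n m (λ i → f (m ℕ.+ i))) ⟩
  ∑< m f + ∑[ r < m ] ∑[ s < n ] f (m ℕ.+ (r ℕ.+ m ℕ.* s))
    ≡⟨ sym (∑-distrib-+ m f _) ⟩
  ∑[ r < m ] (f r + ∑[ s < n ] f (m ℕ.+ (r ℕ.+ m ℕ.* s)))
    ≡⟨ ∑-cong m (λ r _ → cong₂ _+_ (cong f (first-block r)) (∑-cong n (λ s _ → cong f (next-block r s)))) ⟩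
  ∑[ r < m ] ∑[ s < suc n ] f (r ℕ.+ m ℕ.* s) ∎
  where
  open ≡-Reasoning
  first-block : ∀ r → r ≡ r ℕ.+ m ℕ.* 0
  first-block r = sym (trans (cong (r ℕ.+_) (ℕ.*-zeroʳ m)) (ℕ.+-identityʳ r))
  next-block : ∀ r s → m ℕ.+ (r ℕ.+ m ℕ.* s) ≡ r ℕ.+ m ℕ.* suc s
  next-block r s = trans (ℕ.+-comm m _)
    (trans (ℕ.+-assoc r _ m) (cong (r ℕ.+_) (trans (ℕ.+-comm (m ℕ.* s) m) (sym (ℕ.*-suc m s)))))

∑-nonpos : ∀ n {f : ℕ → ℤ} → (∀ i → i < n → f i ≤ℤ + 0) → ∑< n f ≤ℤ + 0
∑-nonpos zero    f≤0 = ℤ.≤-refl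
∑-nonpos (suc n) f≤0 = ℤ.+-mono-≤ (f≤0 0 (s≤s z≤n)) (∑-nonpos n (λ i i<n → f≤0 (suc i) (s≤s i<n)))

+-nonpos-≡0 : ∀ {a b} → a ≤ℤ + 0 → b ≤ℤ + 0 → a + b ≡ + 0 → a ≡ + 0 × b ≡ + 0
+-nonpos-≡0 {a} {b} a≤0 b≤0 a+b≡0 = a≡0 , trans (sym (ℤ.+-identityˡ b)) (trans (cong (_+ b) (sym a≡0)) a+b≡0)
  where
  a≡0 : a ≡ + 0
  a≡0 = ℤ.≤-antisym a≤0 (subst₂ _≤ℤ_ a+b≡0 (ℤ.+-identityʳ a) (ℤ.+-monoʳ-≤ a b≤0))

∑-nonpos-≡0 : ∀ n {f : ℕ → ℤ} → (∀ i → i < n → f i ≤ℤ + 0) → ∑< n f ≡ + 0 → ∀ i → i < n → f i ≡ + 0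
∑-nonpos-≡0 (suc n) {f} f≤0 ∑≡0 i i<n with +-nonpos-≡0 (f≤0 0 (s≤s z≤n)) (∑-nonpos n tail≤0) ∑≡0
  where
  tail≤0 : ∀ i → i < n → f (suc i) ≤ℤ + 0
  tail≤0 i i<n = f≤0 (suc i) (s≤s i<n)
... | head≡0 , tail≡0 with i | i<n
...   | zero  | _         = head≡0
...   | suc i | s≤s i<n   = ∑-nonpos-≡0 n (λ i i<n → f≤0 (suc i) (s≤s i<n)) tail≡0 i i<n

∑ˡ : {A : Set} → List A → (A → ℤ) → ℤ
∑ˡ []       f = + 0
∑ˡ (x ∷ xs) f = f x + ∑ˡ xs f

∑ˡ-++ : {A : Set} (xs ys : List A) (f : A → ℤ) → ∑ˡ (xs ++ ys) f ≡ ∑ˡ xs f + ∑ˡ ys f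
∑ˡ-++ []       ys f = sym (ℤ.+-identityˡ _)
∑ˡ-++ (x ∷ xs) ys f = trans (cong (_+_ (f x)) (∑ˡ-++ xs ys f)) (sym (ℤ.+-assoc (f x) _ _))

∑ˡ-map : {A B : Set} (g : A → B) (xs : List A) (f : B → ℤ) → ∑ˡ (map g xs) f ≡ ∑ˡ xs (f ∘ g)
∑ˡ-map g []       f = refl
∑ˡ-map g (x ∷ xs) f = cong (_+_ (f (g x))) (∑ˡ-map g xs f)

∑ˡ-cartesianProduct : {A B : Set} (xs : List A) (ys : List B) (f : A × B → ℤ) →
                      ∑ˡ (cartesianProduct xs ys) f ≡ ∑ˡ xs (λ x → ∑ˡ ys (λ y → f (x , y)))
∑ˡ-cartesianProduct []       ys f = refl
∑ˡ-cartesianProduct (x ∷ xs) ys f = trans (∑ˡ-++ (map (x ,_) ys) _ f)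
  (cong₂ _+_ (∑ˡ-map (x ,_) ys f) (∑ˡ-cartesianProduct xs ys f))

∑ˡ-applyUpTo : ∀ n (g : ℕ → ℕ) (f : ℕ → ℤ) → ∑ˡ (applyUpTo g n) f ≡ ∑[ i < n ] f (g i)
∑ˡ-applyUpTo zero    g f = refl
∑ˡ-applyUpTo (suc n) g f = cong (_+_ (f (g 0))) (∑ˡ-applyUpTo n (g ∘ suc) f)

length-filter : {A : Set} {P : A → Set} (P? : Decidable P) (xs : List A) → + length (filter P? xs) ≡ ∑ˡ xs (𝟙 ∘ P?)
length-filter P? []       = refl
length-filter P? (x ∷ xs) with P? x
... | yes _ = trans (ℤ.pos-+ 1 (length (filter P? xs))) (cong (_+_ (+ 1)) (length-filter P? xs))
... | no _  = trans (length-filter P? xs) (sym (ℤ.+-identityˡ _))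

mod≡% : ∀ a m .{{_ : NonZero m}} → a mod m ≡ a % m
mod≡% a (suc m) = refl

mod-≡⇔∣ : ∀ m .{{_ : NonZero m}} a b → a mod m ≡ b mod m ⇔ + m ∣ℤ + a - + b
mod-≡⇔∣ m a b = mk⇔ to from
  where
  a≡a%m : + m ∣ℤ + a - + (a % m)
  a≡a%m = proj₂ (proj₂ (residue m (+ a)))
  b≡b%m : + m ∣ℤ + b - + (b % m)
  b≡b%m = proj₂ (proj₂ (residue m (+ b)))
  to : a mod m ≡ b mod m → + m ∣ℤ + a - + b
  to eq = ∣-linear (+ 1) (- + 1) (telescope (+ a) (+ b) (+ (a % m)))
                   a≡a%m (subst (λ r → + m ∣ℤ + b - + r) (sym (trans (sym (mod≡% a m)) (trans eq (mod≡% b m)))) b≡b%m)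
    where
    telescope : ∀ a b r → a - b ≡ + 1 * (a - r) + - + 1 * (b - r)
    telescope = solve-∀
  from : + m ∣ℤ + a - + b → a mod m ≡ b mod m
  from a≡b = trans (mod≡% a m) (trans (residue-unique (m%n<n a m) (m%n<n b m)
    (∣-linear (+ 1) (+ 1) (telescope (+ a) (+ b) (+ (a % m)) (+ (b % m))) (∣m∣n⇒∣m-n a≡b a≡a%m) b≡b%m))
    (sym (mod≡% b m)))
    where
    telescope : ∀ a b r s → r - s ≡ + 1 * ((a - b) - (a - r)) + + 1 * (b - s)
    telescope = solve-∀

module Modulo (p : ℕ) (p-prime : Prime p) where

  instance
    p≢0 : NonZero p
    p≢0 = prime⇒nonZero p-prime

  infix 4 _≡ₚ_
  _≡ₚ_ : ℤ → ℤ → Set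
  x ≡ₚ y = + p ∣ℤ x - y

  ≡ₚ-sym : ∀ {x y} → x ≡ₚ y → y ≡ₚ x
  ≡ₚ-sym {x} {y} = subst (+ p ∣ℤ_) (flip x y) ∘ ∣m⇒∣-m
    where
    flip : ∀ x y → - (x - y) ≡ y - x
    flip = solve-∀

  ≡ₚ-trans : ∀ {x y z} → x ≡ₚ y → y ≡ₚ z → x ≡ₚ z
  ≡ₚ-trans {x} {y} {z} = ∣-linear (+ 1) (+ 1) (telescope x y z)
    where
    telescope : ∀ x y z → x - z ≡ + 1 * (x - y) + + 1 * (y - z)
    telescope = solve-∀

  ∣*⇒∣⊎∣ : ∀ a b → + p ∣ℤ a * b → + p ∣ℤ a ⊎ + p ∣ℤ b
  ∣*⇒∣⊎∣ a b p∣ab with euclidsLemma (abs a) (abs b) p-prime (subst (p ∣_) (ℤ.abs-* a b) (∣⇒∣ᵤ p∣ab))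
  ... | inj₁ p∣a = inj₁ (∣ᵤ⇒∣ p∣a)
  ... | inj₂ p∣b = inj₂ (∣ᵤ⇒∣ p∣b)

  ∤-* : ∀ {a b} → ¬ + p ∣ℤ a → ¬ + p ∣ℤ b → ¬ + p ∣ℤ a * b
  ∤-* p∤a p∤b p∣ab = [ p∤a , p∤b ] (∣*⇒∣⊎∣ _ _ p∣ab)

  ∤-neg : ∀ {z} → ¬ + p ∣ℤ z → ¬ + p ∣ℤ - z
  ∤-neg {z} p∤z = p∤z ∘ subst (+ p ∣ℤ_) (ℤ.neg-involutive z) ∘ ∣m⇒∣-m

  ∤1 : ¬ + p ∣ℤ + 1
  ∤1 p∣1 = ℕ.nonTrivial⇒≢1 {{prime⇒nonTrivial p-prime}} (ℕ.∣1⇒≡1 (∣⇒∣ᵤ p∣1))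

  ∤-small : ∀ {i} → i < p → i ≢ 0 → ¬ + p ∣ℤ + i
  ∤-small {i} i<p i≢0 p∣i =
    i≢0 (residue-unique i<p (ℕ.≤-<-trans z≤n i<p) (subst (+ p ∣ℤ_) (sym (ℤ.+-identityʳ (+ i))) p∣i))

  inverseℕ : ∀ {n} → ¬ p ∣ n → ∃ λ b → + n * b ≡ₚ + 1
  inverseℕ {n} p∤n with coprime-Bézout coprime
    where
    coprime : Coprime n p
    coprime (d∣n , d∣p) with prime⇒irreducible p-prime d∣p
    ... | inj₁ d≡1 = d≡1
    ... | inj₂ refl = contradiction d∣n p∤n
  ... | Bézout.+- x y eq = + x , divides (+ y) (begin
    + n * + x - + 1             ≡⟨ cong (_- + 1) (trans (ℤ.*-comm (+ n) (+ x)) (sym (ℤ.pos-* x n))) ⟩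
    + (x ℕ.* n) - + 1           ≡⟨ cong (λ z → + z - + 1) (sym eq) ⟩
    + (1 ℕ.+ y ℕ.* p) - + 1     ≡⟨ cong (_- + 1) (trans (ℤ.pos-+ 1 (y ℕ.* p)) (cong (_+_ (+ 1)) (ℤ.pos-* y p))) ⟩
    + 1 + + y * + p - + 1       ≡⟨ cancel (+ y * + p) ⟩
    + y * + p                   ∎)
    where
    open ≡-Reasoning
    cancel : ∀ a → + 1 + a - + 1 ≡ a
    cancel = solve-∀
  ... | Bézout.-+ x y eq = - + x , divides (- + y) (begin
    + n * - + x - + 1           ≡⟨ negate (+ n) (+ x) ⟩
    - (+ 1 + + x * + n)         ≡⟨ cong (λ z → - (+ 1 + z)) (sym (ℤ.pos-* x n)) ⟩
    - (+ 1 + + (x ℕ.* n))       ≡⟨ cong (λ z → - z) (trans (sym (ℤ.pos-+ 1 (x ℕ.* n))) (cong +_ eq)) ⟩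
    - + (y ℕ.* p)               ≡⟨ cong -_ (ℤ.pos-* y p) ⟩
    - (+ y * + p)               ≡⟨ ℤ.neg-distribˡ-* (+ y) (+ p) ⟩
    - + y * + p                 ∎)
    where
    open ≡-Reasoning
    negate : ∀ a b → a * - b - + 1 ≡ - (+ 1 + b * a)
    negate = solve-∀

  inverse : ∀ {a} → ¬ + p ∣ℤ a → ∃ λ b → a * b ≡ₚ + 1
  inverse {+ n}      p∤a = inverseℕ (p∤a ∘ ∣ᵤ⇒∣)
  inverse { -[1+ n ]} p∤a with inverseℕ (p∤a ∘ ∣ᵤ⇒∣)
  ... | b , nb≡1 = - b , subst (+ p ∣ℤ_) (negate (+ suc n) b) nb≡1
    where
    negate : ∀ a b → a * b - + 1 ≡ - a * - b - + 1
    negate = solve-∀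

  [p∣]-cong : ∀ x y → x ≡ₚ y → [ p ∣ x ] ≡ [ p ∣ y ]
  [p∣]-cong x y p∣x-y = [∣]-cong
    (λ p∣x → ∣-linear (+ 1) (- + 1) (shift₁ x y) p∣x p∣x-y)
    (λ p∣y → ∣-linear (+ 1) (+ 1) (shift₂ x y) p∣y p∣x-y)
    where
    shift₁ : ∀ x y → y ≡ + 1 * x + - + 1 * (x - y)
    shift₁ = solve-∀
    shift₂ : ∀ x y → x ≡ + 1 * y + + 1 * (x - y)
    shift₂ = solve-∀

  ∑-residues : ∀ (f : ℤ → ℤ) → (∀ x y → x ≡ₚ y → f x ≡ f y) →
               ∀ z → ∑[ w < p ] ([ p ∣ z - + w ] * f (+ w)) ≡ f z
  ∑-residues f f-cong z with residue p z
  ... | r , r<p , p∣z-r = trans (∑-single p r r<p others) (begin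
    [ p ∣ z - + r ] * f (+ r) ≡⟨ cong (_* f (+ r)) ([∣]-yes p∣z-r) ⟩
    + 1 * f (+ r)             ≡⟨ ℤ.*-identityˡ (f (+ r)) ⟩
    f (+ r)                   ≡⟨ f-cong (+ r) z (≡ₚ-sym {z} p∣z-r) ⟩
    f z                       ∎)
    where
    open ≡-Reasoning
    others : ∀ w → w < p → w ≢ r → [ p ∣ z - + w ] * f (+ w) ≡ + 0
    others w w<p w≢r = trans (cong (_* f (+ w)) ([∣]-no
      (λ p∣z-w → w≢r (residue-unique w<p r<p (≡ₚ-trans {+ w} {z} (≡ₚ-sym {z} p∣z-w) p∣z-r)))))
      (ℤ.*-zeroˡ (f (+ w)))

  linear-root-count : ∀ {α} β → ¬ + p ∣ℤ α → ∑[ t < p ] [ p ∣ β + α * + t ] ≡ + 1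
  linear-root-count {α} β p∤α with inverse p∤α
  ... | α⁻¹ , αα⁻¹≡1 with residue p (- β * α⁻¹)
  ...   | t₀ , t₀<p , p∣t₀-root = trans (∑-single p t₀ t₀<p others) ([∣]-yes root)
    where
    root : + p ∣ℤ β + α * + t₀
    root = ∣-linear (- β) (- α) (root-identity α β α⁻¹ (+ t₀)) αα⁻¹≡1 p∣t₀-root
      where
      root-identity : ∀ α β α⁻¹ t → β + α * t ≡ - β * (α * α⁻¹ - + 1) + - α * (- β * α⁻¹ - t)
      root-identity = solve-∀
    unique : ∀ t → + p ∣ℤ β + α * + t → + p ∣ℤ + t - + t₀
    unique t p∣β+αt = fromInj₂ (λ p∣α → contradiction p∣α p∤α)
      (∣*⇒∣⊎∣ α (+ t - + t₀) (∣-linear (+ 1) (- + 1) (difference α β (+ t) (+ t₀)) p∣β+αt root))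
      where
      difference : ∀ α β t t₀ → α * (t - t₀) ≡ + 1 * (β + α * t) + - + 1 * (β + α * t₀)
      difference = solve-∀
    others : ∀ t → t < p → t ≢ t₀ → [ p ∣ β + α * + t ] ≡ + 0
    others t t<p t≢t₀ = [∣]-no (t≢t₀ ∘ residue-unique t<p t₀<p ∘ unique t)

  ∑-affine : ∀ (f : ℤ → ℤ) → (∀ x y → x ≡ₚ y → f x ≡ f y) →
             ∀ {α} β → ¬ + p ∣ℤ α → ∑[ x < p ] f (α * + x + β) ≡ ∑[ x < p ] f (+ x)
  ∑-affine f f-cong {α} β p∤α = begin
    ∑[ x < p ] f (α * + x + β)
      ≡⟨ ∑-cong p (λ x _ → sym (∑-residues f f-cong (α * + x + β))) ⟩
    ∑[ x < p ] ∑[ w < p ] ([ p ∣ α * + x + β - + w ] * f (+ w))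
      ≡⟨ ∑-comm p p _ ⟩
    ∑[ w < p ] ∑[ x < p ] ([ p ∣ α * + x + β - + w ] * f (+ w))
      ≡⟨ ∑-cong p (λ w _ → sym (*-distribʳ-∑ p (f (+ w)) _)) ⟩
    ∑[ w < p ] (∑[ x < p ] [ p ∣ α * + x + β - + w ] * f (+ w))
      ≡⟨ ∑-cong p (λ w _ → cong (_* f (+ w)) (trans (∑-cong p (λ x _ → cong (λ z → [ p ∣ z ]) (reorder α (+ x) β (+ w))))
                                                    (linear-root-count (β - + w) p∤α))) ⟩
    ∑[ w < p ] (+ 1 * f (+ w))
      ≡⟨ ∑-cong p (λ w _ → ℤ.*-identityˡ (f (+ w))) ⟩
    ∑[ x < p ] f (+ x) ∎
    where
    open ≡-Reasoning
    reorder : ∀ α x β w → α * x + β - w ≡ (β - w) + α * x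
    reorder = solve-∀

  ∑∑-linear-root-count : ∀ {α β} γ → ¬ + p ∣ℤ α ⊎ ¬ + p ∣ℤ β →
                         ∑[ s < p ] ∑[ t < p ] [ p ∣ γ + α * + s + β * + t ] ≡ + p
  ∑∑-linear-root-count {α} {β} γ (inj₁ p∤α) = begin
    ∑[ s < p ] ∑[ t < p ] [ p ∣ γ + α * + s + β * + t ]
      ≡⟨ ∑-comm p p _ ⟩
    ∑[ t < p ] ∑[ s < p ] [ p ∣ γ + α * + s + β * + t ]
      ≡⟨ ∑-cong p (λ t _ → trans (∑-cong p (λ s _ → cong (λ z → [ p ∣ z ]) (reorder γ α (+ s) β (+ t))))
                                 (linear-root-count (γ + β * + t) p∤α)) ⟩
    ∑[ t < p ] (+ 1)
      ≡⟨ trans (∑-const p (+ 1)) (ℤ.*-identityʳ (+ p)) ⟩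
    + p ∎
    where
    open ≡-Reasoning
    reorder : ∀ γ α s β t → γ + α * s + β * t ≡ (γ + β * t) + α * s
    reorder = solve-∀
  ∑∑-linear-root-count {α} {β} γ (inj₂ p∤β) = begin
    ∑[ s < p ] ∑[ t < p ] [ p ∣ γ + α * + s + β * + t ]
      ≡⟨ ∑-cong p (λ s _ → linear-root-count (γ + α * + s) p∤β) ⟩
    ∑[ s < p ] (+ 1)
      ≡⟨ trans (∑-const p (+ 1)) (ℤ.*-identityʳ (+ p)) ⟩
    + p ∎
    where open ≡-Reasoning

  #√ : ℤ → ℤ
  #√ u = ∑[ a < p ] [ p ∣ + a * + a - u ]

  χ : ℤ → ℤ
  χ u = #√ u - + 1

  IsSquare : ℤ → Set
  IsSquare u = ∃ λ x → x * x ≡ₚ u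

  #√-cong : ∀ u v → u ≡ₚ v → #√ u ≡ #√ v
  #√-cong u v u≡v = ∑-cong p (λ a _ →
    [p∣]-cong (+ a * + a - u) (+ a * + a - v) (subst (+ p ∣ℤ_) (shift (+ a) u v) (≡ₚ-sym {u} u≡v)))
    where
    shift : ∀ a u v → v - u ≡ (a * a - u) - (a * a - v)
    shift = solve-∀

  χ-cong : ∀ u v → u ≡ₚ v → χ u ≡ χ v
  χ-cong u v u≡v = cong (_- + 1) (#√-cong u v u≡v)

  #√-zero : ∀ {u} → + p ∣ℤ u → #√ u ≡ + 1
  #√-zero {u} p∣u = trans (∑-single p 0 (ℕ.>-nonZero⁻¹ p) others) ([∣]-yes p∣0-u)
    where
    p∣0-u : + p ∣ℤ + 0 * + 0 - u
    p∣0-u = subst (+ p ∣ℤ_) (sym (ℤ.+-identityˡ (- u))) (∣m⇒∣-m p∣u)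
    square : ∀ a u → a * a ≡ + 1 * (a * a - u) + + 1 * u
    square = solve-∀
    others : ∀ a → a < p → a ≢ 0 → [ p ∣ + a * + a - u ] ≡ + 0
    others a a<p a≢0 = [∣]-no λ p∣aa-u →
      [ ∤-small a<p a≢0 , ∤-small a<p a≢0 ] (∣*⇒∣⊎∣ (+ a) (+ a) (∣-linear (+ 1) (+ 1) (square (+ a) u) p∣aa-u p∣u))

  χ-zero : ∀ {u} → + p ∣ℤ u → χ u ≡ + 0
  χ-zero p∣u = cong (_- + 1) (#√-zero p∣u)

  ∑-#√ : ∑[ u < p ] #√ (+ u) ≡ + p
  ∑-#√ = begin
    ∑[ u < p ] ∑[ a < p ] [ p ∣ + a * + a - + u ]  ≡⟨ ∑-comm p p _ ⟩
    ∑[ a < p ] ∑[ u < p ] [ p ∣ + a * + a - + u ]  ≡⟨ ∑-cong p (λ a _ → one-root (+ a * + a)) ⟩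
    ∑[ a < p ] (+ 1)                               ≡⟨ ∑-const p (+ 1) ⟩
    + p * + 1                                      ≡⟨ ℤ.*-identityʳ (+ p) ⟩
    + p                                            ∎
    where
    open ≡-Reasoning
    minus : ∀ z u → z - u ≡ z + - + 1 * u
    minus = solve-∀
    one-root : ∀ z → ∑[ u < p ] [ p ∣ z - + u ] ≡ + 1
    one-root z = trans (∑-cong p (λ u _ → cong (λ e → [ p ∣ e ]) (minus z (+ u)))) (linear-root-count z (∤-neg ∤1))

  ∑-χ : ∑[ u < p ] χ (+ u) ≡ + 0
  ∑-χ = begin
    ∑[ u < p ] (#√ (+ u) + - + 1)       ≡⟨ ∑-distrib-+ p (#√ ∘ +_) (λ _ → - + 1) ⟩
    ∑[ u < p ] #√ (+ u) + ∑[ u < p ] (- + 1) ≡⟨ cong₂ _+_ ∑-#√ (∑-const p (- + 1)) ⟩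
    + p + + p * - + 1                   ≡⟨ cancel (+ p) ⟩
    + 0                                 ∎
    where
    open ≡-Reasoning
    cancel : ∀ x → x + x * - + 1 ≡ + 0
    cancel = solve-∀

  ∤-square-root : ∀ {x u} → ¬ + p ∣ℤ u → x * x ≡ₚ u → ¬ + p ∣ℤ x
  ∤-square-root {x} {u} p∤u xx≡u p∣x = p∤u (∣-linear x (- + 1) (square x u) p∣x xx≡u)
    where
    square : ∀ x u → u ≡ x * x + - + 1 * (x * x - u)
    square = solve-∀

  square-* : ∀ {u v} → IsSquare u → IsSquare v → IsSquare (u * v)
  square-* {u} {v} (x , xx≡u) (y , yy≡v) = x * y , ∣-linear (y * y) u (product x y u v) xx≡u yy≡v
    where
    product : ∀ x y u v → x * y * (x * y) - u * v ≡ y * y * (x * x - u) + u * (y * y - v)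
    product = solve-∀

  square*nonsquare : ∀ {u v} → ¬ + p ∣ℤ u → IsSquare u → ¬ IsSquare v → ¬ IsSquare (u * v)
  square*nonsquare {u} {v} p∤u (x , xx≡u) v-nonsquare (z , zz≡uv) with inverse (∤-square-root {x} p∤u xx≡u)
  ... | y , xy≡1 = v-nonsquare (z * y , ∣-linear (+ 1) (v * (x * y + + 1)) (quotient x y z u v)
                     (∣-linear (y * y) (- (v * y * y)) refl zz≡uv xx≡u) xy≡1)
    where
    quotient : ∀ x y z u v → z * y * (z * y) - v
             ≡ + 1 * (y * y * (z * z - u * v) + - (v * y * y) * (x * x - u)) + v * (x * y + + 1) * (x * y - + 1)
    quotient = solve-∀

𝒩 : ℤ → ℤ → ℤ → ℤ
𝒩 d x y = x * x - d * (y * y)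

𝒩-shift : ∀ d x y M s t →
          𝒩 d (x + M * s) (y + M * t) ≡ 𝒩 d x y + M * (+ 2 * x * s - + 2 * d * y * t) + M * M * (s * s - d * (t * t))
𝒩-shift = expansion
  where
  expansion : ∀ d x y M s t → (x + M * s) * (x + M * s) - d * ((y + M * t) * (y + M * t))
            ≡ x * x - d * (y * y) + M * (+ 2 * x * s - + 2 * d * y * t) + M * M * (s * s - d * (t * t))
  expansion = solve-∀

#solutions : ℕ → ℤ → ℤ → ℤ
#solutions m d c = ∑[ a < m ] ∑[ b < m ] [ m ∣ 𝒩 d (+ a) (+ b) + c ]

module OddModulo (p : ℕ) (p-prime : Prime p) (p∤2 : ¬ + p ∣ℤ + 2) where

  open Modulo p p-prime public

  residue-square : ∀ {u} → IsSquare u → ∃ λ a → a < p × + a * + a ≡ₚ u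
  residue-square {u} (x , xx≡u) with residue p x
  ... | a , a<p , x≡a = a , a<p , ∣-linear (+ 1) (- (x + + a)) (shift x (+ a) u) xx≡u x≡a
    where
    shift : ∀ x a u → a * a - u ≡ + 1 * (x * x - u) + - (x + a) * (x - a)
    shift = solve-∀

  square? : ∀ u → Dec (IsSquare u)
  square? u with ℕ.anyUpTo? (λ a → + p ∣ℤ? + a * + a - u) p
  ... | yes (a , _ , aa≡u) = yes (+ a , aa≡u)
  ... | no no-residue      = no (no-residue ∘ residue-square)

  nonsquare⇒∤ : ∀ {u} → ¬ IsSquare u → ¬ + p ∣ℤ u
  nonsquare⇒∤ {u} u-nonsquare p∣u = u-nonsquare (+ 0 , subst (+ p ∣ℤ_) (sym (ℤ.+-identityˡ (- u))) (∣m⇒∣-m p∣u))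

  #√-nonsquare : ∀ {u} → ¬ IsSquare u → #√ u ≡ + 0
  #√-nonsquare u-nonsquare = ∑-zero p (λ a _ → [∣]-no (λ aa≡u → u-nonsquare (+ a , aa≡u)))

  #√-square : ∀ {u} → ¬ + p ∣ℤ u → IsSquare u → #√ u ≡ + 2
  #√-square {u} p∤u u-square with residue-square u-square
  ... | a₀ , a₀<p , a₀a₀≡u with residue p (- + a₀)
  ...   | a₁ , a₁<p , -a₀≡a₁ =
    trans (∑-cong p roots)
          (trans (∑-distrib-+ p (δ a₀) (δ a₁)) (cong₂ _+_ (∑-δ a₀<p) (∑-δ a₁<p)))
    where
    δ : ℕ → ℕ → ℤ
    δ c a = 𝟙 (a ℕ.≟ c)
    ∑-δ : ∀ {c} → c < p → ∑< p (δ c) ≡ + 1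
    ∑-δ {c} c<p = trans (∑-single p c c<p (λ a _ a≢c → 𝟙-no (a ℕ.≟ c) a≢c)) (𝟙-yes (c ℕ.≟ c) refl)
    a₁+a₀≡0 : + p ∣ℤ + a₁ + + a₀
    a₁+a₀≡0 = subst (+ p ∣ℤ_) (flip (+ a₀) (+ a₁)) (∣m⇒∣-m -a₀≡a₁)
      where
      flip : ∀ a₀ a₁ → - (- a₀ - a₁) ≡ a₁ + a₀
      flip = solve-∀
    a₀≢a₁ : a₀ ≢ a₁
    a₀≢a₁ refl = [ p∤2 , ∤-square-root {+ a₀} p∤u a₀a₀≡u ]
                   (∣*⇒∣⊎∣ (+ 2) (+ a₀) (subst (+ p ∣ℤ_) (double (+ a₀)) a₁+a₀≡0))
      where
      double : ∀ a → a + a ≡ + 2 * a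
      double = solve-∀
    a₁a₁≡u : + a₁ * + a₁ ≡ₚ u
    a₁a₁≡u = ∣-linear (+ 1) (+ a₁ - + a₀) (other-root (+ a₀) (+ a₁) u) a₀a₀≡u a₁+a₀≡0
      where
      other-root : ∀ a₀ a₁ u → a₁ * a₁ - u ≡ + 1 * (a₀ * a₀ - u) + (a₁ - a₀) * (a₁ + a₀)
      other-root = solve-∀
    only-roots : ∀ {a} → a < p → a ≢ a₀ → a ≢ a₁ → ¬ + a * + a ≡ₚ u
    only-roots {a} a<p a≢a₀ a≢a₁ aa≡u =
      [ a≢a₀ ∘ residue-unique a<p a₀<p , a≢a₁ ∘ residue-unique a<p a₁<p ∘ a≡a₁ ]
        (∣*⇒∣⊎∣ (+ a - + a₀) (+ a + + a₀) (∣-linear (+ 1) (- + 1) (factor (+ a) (+ a₀) u) aa≡u a₀a₀≡u))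
      where
      factor : ∀ a a₀ u → (a - a₀) * (a + a₀) ≡ + 1 * (a * a - u) + - + 1 * (a₀ * a₀ - u)
      factor = solve-∀
      shift : ∀ a a₀ a₁ → a - a₁ ≡ + 1 * (a + a₀) + - + 1 * (a₁ + a₀)
      shift = solve-∀
      a≡a₁ : + p ∣ℤ + a + + a₀ → + p ∣ℤ + a - + a₁
      a≡a₁ a+a₀≡0 = ∣-linear (+ 1) (- + 1) (shift (+ a) (+ a₀) (+ a₁)) a+a₀≡0 a₁+a₀≡0
    roots : ∀ a → a < p → [ p ∣ + a * + a - u ] ≡ δ a₀ a + δ a₁ a
    roots a a<p with a ℕ.≟ a₀ | a ℕ.≟ a₁
    ... | yes refl | yes refl = contradiction refl a₀≢a₁
    ... | yes refl | no _     = [∣]-yes a₀a₀≡u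
    ... | no _     | yes refl = [∣]-yes a₁a₁≡u
    ... | no a≢a₀  | no a≢a₁  = [∣]-no (only-roots a<p a≢a₀ a≢a₁)

  χ-nonsquare : ∀ {u} → ¬ IsSquare u → χ u ≡ - + 1
  χ-nonsquare u-nonsquare = cong (_- + 1) (#√-nonsquare u-nonsquare)

  χ-square : ∀ {u} → ¬ + p ∣ℤ u → IsSquare u → χ u ≡ + 1
  χ-square p∤u u-square = cong (_- + 1) (#√-square p∤u u-square)

  χ≤1 : ∀ u → χ u ≤ℤ + 1
  χ≤1 u with + p ∣ℤ? u | square? u
  ... | yes p∣u | _              = subst (_≤ℤ + 1) (sym (χ-zero p∣u)) (+≤+ z≤n)
  ... | no p∤u  | yes u-square   = ℤ.≤-reflexive (χ-square p∤u u-square)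
  ... | no _    | no u-nonsquare = subst (_≤ℤ + 1) (sym (χ-nonsquare u-nonsquare)) -≤+

  ∑χ[u*]≡0 : ∀ {u} → ¬ + p ∣ℤ u → ∑[ x < p ] χ (u * + x) ≡ + 0
  ∑χ[u*]≡0 {u} p∤u = trans (∑-cong p (λ x _ → cong χ (sym (ℤ.+-identityʳ (u * + x)))))
                            (trans (∑-affine χ χ-cong (+ 0) p∤u) ∑-χ)

  χ[nonsquare*]+χ≤0 : ∀ {u} → ¬ IsSquare u → ∀ x → χ (u * x) + χ x ≤ℤ + 0
  χ[nonsquare*]+χ≤0 {u} u-nonsquare x with + p ∣ℤ? x | square? x
  ... | yes p∣x | _              = ℤ.≤-reflexive (cong₂ _+_ (χ-zero (∣n⇒∣m*n u p∣x)) (χ-zero p∣x))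
  ... | no p∤x  | yes x-square   = ℤ.≤-reflexive (cong₂ _+_ χ[ux]≡-1 (χ-square p∤x x-square))
    where
    χ[ux]≡-1 : χ (u * x) ≡ - + 1
    χ[ux]≡-1 = trans (cong χ (ℤ.*-comm u x)) (χ-nonsquare (square*nonsquare p∤x x-square u-nonsquare))
  ... | _       | no x-nonsquare = ℤ.+-mono-≤ (χ≤1 (u * x)) (ℤ.≤-reflexive (χ-nonsquare x-nonsquare))

  -- The terms χ (u x) + χ x are nonpositive and sum to zero, so each vanishes; at x ≡ v this gives χ (u v) = - χ v.
  χ-nonsquare*nonsquare : ∀ {u v} → ¬ IsSquare u → ¬ IsSquare v → χ (u * v) ≡ + 1
  χ-nonsquare*nonsquare {u} {v} u-nonsquare v-nonsquare with residue p v
  ... | v₀ , v₀<p , v≡v₀ = begin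
    χ (u * v)                          ≡⟨ χ-cong _ _ (subst (+ p ∣ℤ_) (distrib u v (+ v₀)) (∣n⇒∣m*n u v≡v₀)) ⟩
    χ (u * + v₀)                       ≡⟨ sym (cancel (χ (u * + v₀)) (χ (+ v₀))) ⟩
    χ (u * + v₀) + χ (+ v₀) - χ (+ v₀) ≡⟨ cong₂ _-_ (∑-nonpos-≡0 p (λ x _ → χ[nonsquare*]+χ≤0 u-nonsquare (+ x)) ∑≡0 v₀ v₀<p)
                                                     (trans (χ-cong _ _ (≡ₚ-sym {v} v≡v₀)) (χ-nonsquare v-nonsquare)) ⟩
    + 0 - - + 1                        ≡⟨⟩
    + 1                                ∎
    where
    open ≡-Reasoning
    distrib : ∀ u v w → u * (v - w) ≡ u * v - u * w
    distrib = solve-∀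
    cancel : ∀ a b → a + b - b ≡ a
    cancel = solve-∀
    ∑≡0 : ∑[ x < p ] (χ (u * + x) + χ (+ x)) ≡ + 0
    ∑≡0 = trans (∑-distrib-+ p (λ x → χ (u * + x)) (χ ∘ +_)) (cong₂ _+_ (∑χ[u*]≡0 (nonsquare⇒∤ u-nonsquare)) ∑-χ)

  χ-* : ∀ u v → χ (u * v) ≡ χ u * χ v
  χ-* u v with + p ∣ℤ? u | + p ∣ℤ? v
  ... | yes p∣u | _ = begin
    χ (u * v)   ≡⟨ χ-zero (∣m⇒∣m*n v p∣u) ⟩
    + 0         ≡⟨ sym (ℤ.*-zeroˡ (χ v)) ⟩
    + 0 * χ v   ≡⟨ cong (_* χ v) (sym (χ-zero p∣u)) ⟩
    χ u * χ v   ∎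
    where open ≡-Reasoning
  ... | no _ | yes p∣v = begin
    χ (u * v)   ≡⟨ χ-zero (∣n⇒∣m*n u p∣v) ⟩
    + 0         ≡⟨ sym (ℤ.*-zeroʳ (χ u)) ⟩
    χ u * + 0   ≡⟨ cong (χ u *_) (sym (χ-zero p∣v)) ⟩
    χ u * χ v   ∎
    where open ≡-Reasoning
  ... | no p∤u | no p∤v with square? u | square? v
  ...   | yes u-square | yes v-square =
    trans (χ-square (∤-* p∤u p∤v) (square-* u-square v-square))
          (sym (cong₂ _*_ (χ-square p∤u u-square) (χ-square p∤v v-square)))
  ...   | yes u-square | no v-nonsquare =
    trans (χ-nonsquare (square*nonsquare p∤u u-square v-nonsquare))
          (sym (cong₂ _*_ (χ-square p∤u u-square) (χ-nonsquare v-nonsquare)))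
  ...   | no u-nonsquare | yes v-square =
    trans (cong χ (ℤ.*-comm u v)) (trans (χ-nonsquare (square*nonsquare p∤v v-square u-nonsquare))
          (sym (cong₂ _*_ (χ-nonsquare u-nonsquare) (χ-square p∤v v-square))))
  ...   | no u-nonsquare | no v-nonsquare =
    trans (χ-nonsquare*nonsquare u-nonsquare v-nonsquare)
          (sym (cong₂ _*_ (χ-nonsquare u-nonsquare) (χ-nonsquare v-nonsquare)))

  χ²≡1 : ∀ {d} → ¬ + p ∣ℤ d → χ d * χ d ≡ + 1
  χ²≡1 {d} p∤d = trans (sym (χ-* d d)) (χ-square (∤-* p∤d p∤d) (d , divides (+ 0) (ℤ.+-inverseʳ (d * d))))

  #solutions≡∑#√#√ : ∀ d c → #solutions p d c ≡ ∑[ y < p ] (#√ (+ y) * #√ (d * + y - c))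
  #solutions≡∑#√#√ d c = begin
    ∑[ a < p ] ∑[ b < p ] [ p ∣ 𝒩 d (+ a) (+ b) + c ]
      ≡⟨ ∑-comm p p _ ⟩
    ∑[ b < p ] ∑[ a < p ] [ p ∣ 𝒩 d (+ a) (+ b) + c ]
      ≡⟨ ∑-cong p (λ b _ → ∑-cong p (λ a _ → cong (λ e → [ p ∣ e ]) (regroup (+ a) (+ b) d c))) ⟩
    ∑[ b < p ] #√[d*-c] (+ b * + b)
      ≡⟨ ∑-cong p (λ b _ → sym (∑-residues #√[d*-c] #√[d*-c]-cong (+ b * + b))) ⟩
    ∑[ b < p ] ∑[ y < p ] ([ p ∣ + b * + b - + y ] * #√[d*-c] (+ y))
      ≡⟨ ∑-comm p p _ ⟩
    ∑[ y < p ] ∑[ b < p ] ([ p ∣ + b * + b - + y ] * #√[d*-c] (+ y))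
      ≡⟨ ∑-cong p (λ y _ → sym (*-distribʳ-∑ p (#√[d*-c] (+ y)) _)) ⟩
    ∑[ y < p ] (#√ (+ y) * #√ (d * + y - c)) ∎
    where
    open ≡-Reasoning
    #√[d*-c] : ℤ → ℤ
    #√[d*-c] y = #√ (d * y - c)
    #√[d*-c]-cong : ∀ x y → x ≡ₚ y → #√[d*-c] x ≡ #√[d*-c] y
    #√[d*-c]-cong x y x≡y = #√-cong _ _ (subst (+ p ∣ℤ_) (scale d x y c) (∣n⇒∣m*n d x≡y))
      where
      scale : ∀ d x y c → d * (x - y) ≡ d * x - c - (d * y - c)
      scale = solve-∀
    regroup : ∀ a b d c → a * a - d * (b * b) + c ≡ a * a - (d * (b * b) - c)
    regroup = solve-∀

  ∑#√#√≡p+∑χχ : ∀ {d} c → ¬ + p ∣ℤ d →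
                ∑[ y < p ] (#√ (+ y) * #√ (d * + y - c)) ≡ + p + ∑[ y < p ] (χ (+ y) * χ (d * + y - c))
  ∑#√#√≡p+∑χχ {d} c p∤d = begin
    ∑[ y < p ] (#√ (+ y) * #√ (d * + y - c))
      ≡⟨ ∑-cong p (λ y _ → expand (#√ (+ y)) (#√ (d * + y - c))) ⟩
    ∑[ y < p ] ((+ 1 + χ (+ y)) + (χ (d * + y - c) + χ (+ y) * χ (d * + y - c)))
      ≡⟨ ∑-distrib-+ p _ _ ⟩
    ∑[ y < p ] (+ 1 + χ (+ y)) + ∑[ y < p ] (χ (d * + y - c) + χ (+ y) * χ (d * + y - c))
      ≡⟨ cong₂ _+_ (∑-distrib-+ p _ _) (∑-distrib-+ p _ _) ⟩
    (∑[ y < p ] (+ 1) + ∑[ y < p ] χ (+ y)) + (∑[ y < p ] χ (d * + y - c) + ∑χχ)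
      ≡⟨ cong₂ _+_ (cong₂ _+_ (trans (∑-const p (+ 1)) (ℤ.*-identityʳ (+ p))) ∑-χ)
                   (cong (_+ ∑χχ) (trans (∑-affine χ χ-cong (- c) p∤d) ∑-χ)) ⟩
    (+ p + + 0) + (+ 0 + ∑χχ)
      ≡⟨ drop-zeros (+ p) ∑χχ ⟩
    + p + ∑χχ ∎
    where
    open ≡-Reasoning
    ∑χχ : ℤ
    ∑χχ = ∑[ y < p ] (χ (+ y) * χ (d * + y - c))
    expand : ∀ a b → a * b ≡ (+ 1 + (a - + 1)) + ((b - + 1) + (a - + 1) * (b - + 1))
    expand = solve-∀
    drop-zeros : ∀ a b → (a + + 0) + (+ 0 + b) ≡ a + b
    drop-zeros = solve-∀

  ∑[p∣]≡1 : ∑[ v < p ] [ p ∣ + v ] ≡ + 1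
  ∑[p∣]≡1 = trans (∑-cong p (λ v _ → cong (λ e → [ p ∣ e ]) (zero-plus (+ v)))) (linear-root-count (+ 0) ∤1)
    where
    zero-plus : ∀ v → v ≡ + 0 + + 1 * v
    zero-plus = solve-∀

  ∑[p∣uv+c] : ∀ {c} → ¬ + p ∣ℤ c → ∀ v → ∑[ u < p ] [ p ∣ + u * + v + c ] ≡ + 1 - [ p ∣ + v ]
  ∑[p∣uv+c] {c} p∤c v with + p ∣ℤ? + v
  ... | yes p∣v = trans (∑-zero p (λ u _ → [∣]-no λ p∣uv+c →
                             p∤c (∣-linear (+ 1) (- + u) (cancel (+ u) (+ v) c) p∣uv+c p∣v)))
                         (sym (cong (λ e → + 1 - e) ([∣]-yes p∣v)))
    where
    cancel : ∀ u v c → c ≡ + 1 * (u * v + c) + - u * v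
    cancel = solve-∀
  ... | no p∤v = trans (∑-cong p (λ u _ → cong (λ e → [ p ∣ e ]) (commute (+ u) (+ v) c)))
                        (trans (linear-root-count c p∤v) (sym (cong (λ e → + 1 - e) ([∣]-no p∤v))))
    where
    commute : ∀ u v c → u * v + c ≡ c + v * u
    commute = solve-∀

  #solutions-hyperbola : ∀ c → #solutions p (+ 1) c ≡ ∑[ v < p ] ∑[ u < p ] [ p ∣ + u * + v + c ]
  #solutions-hyperbola c = begin
    ∑[ a < p ] ∑[ b < p ] conic (+ a) (+ b)
      ≡⟨ ∑-cong p (λ a _ → sym (∑-affine (conic (+ a)) (conic-cong (+ a)) (- + a) ∤1)) ⟩
    ∑[ a < p ] ∑[ v < p ] conic (+ a) (+ 1 * + v + - + a)
      ≡⟨ ∑-comm p p _ ⟩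
    ∑[ v < p ] ∑[ a < p ] conic (+ a) (+ 1 * + v + - + a)
      ≡⟨ ∑-cong p (λ v _ → ∑-cong p (λ a _ → cong (λ e → [ p ∣ e ]) (difference-of-squares (+ a) (+ v) c))) ⟩
    ∑[ v < p ] ∑[ a < p ] [ p ∣ (+ 2 * + a + - + v) * + v + c ]
      ≡⟨ ∑-cong p (λ v _ → ∑-affine (line (+ v)) (line-cong (+ v)) (- + v) p∤2) ⟩
    ∑[ v < p ] ∑[ u < p ] [ p ∣ + u * + v + c ] ∎
    where
    open ≡-Reasoning
    conic : ℤ → ℤ → ℤ
    conic a b = [ p ∣ 𝒩 (+ 1) a b + c ]
    conic-cong : ∀ a x y → x ≡ₚ y → conic a x ≡ conic a y
    conic-cong a x y x≡y =
      [p∣]-cong (𝒩 (+ 1) a x + c) (𝒩 (+ 1) a y + c) (subst (+ p ∣ℤ_) (factor a x y c) (∣n⇒∣m*n (- (x + y)) x≡y))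
      where
      factor : ∀ a x y c → - (x + y) * (x - y) ≡ a * a - + 1 * (x * x) + c - (a * a - + 1 * (y * y) + c)
      factor = solve-∀
    difference-of-squares : ∀ a v c → a * a - + 1 * ((+ 1 * v + - a) * (+ 1 * v + - a)) + c ≡ (+ 2 * a + - v) * v + c
    difference-of-squares = solve-∀
    line : ℤ → ℤ → ℤ
    line v u = [ p ∣ u * v + c ]
    line-cong : ∀ v x y → x ≡ₚ y → line v x ≡ line v y
    line-cong v x y x≡y = [p∣]-cong (x * v + c) (y * v + c) (subst (+ p ∣ℤ_) (scale x y v c) (∣n⇒∣m*n v x≡y))
      where
      scale : ∀ x y v c → v * (x - y) ≡ x * v + c - (y * v + c)
      scale = solve-∀

  hyperbola-count : ∀ {c} → ¬ + p ∣ℤ c → #solutions p (+ 1) c ≡ + p - + 1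
  hyperbola-count {c} p∤c = begin
    #solutions p (+ 1) c                            ≡⟨ #solutions-hyperbola c ⟩
    ∑[ v < p ] ∑[ u < p ] [ p ∣ + u * + v + c ]     ≡⟨ ∑-cong p (λ v _ → ∑[p∣uv+c] p∤c v) ⟩
    ∑[ v < p ] (+ 1 - [ p ∣ + v ])                  ≡⟨ ∑-distrib-- p (λ _ → + 1) (λ v → [ p ∣ + v ]) ⟩
    ∑[ v < p ] (+ 1) - ∑[ v < p ] [ p ∣ + v ]       ≡⟨ cong₂ _-_ (trans (∑-const p (+ 1)) (ℤ.*-identityʳ (+ p))) ∑[p∣]≡1 ⟩
    + p - + 1                                       ∎
    where open ≡-Reasoning

  ∑χχ≡-1 : ∀ {c} → ¬ + p ∣ℤ c → ∑[ y < p ] (χ (+ y) * χ (+ 1 * + y - c)) ≡ - + 1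
  ∑χχ≡-1 {c} p∤c = +-cancelˡ (+ p) _ _ (begin
    + p + ∑[ y < p ] (χ (+ y) * χ (+ 1 * + y - c))  ≡⟨ sym (∑#√#√≡p+∑χχ c ∤1) ⟩
    ∑[ y < p ] (#√ (+ y) * #√ (+ 1 * + y - c))      ≡⟨ sym (#solutions≡∑#√#√ (+ 1) c) ⟩
    #solutions p (+ 1) c                             ≡⟨ hyperbola-count p∤c ⟩
    + p - + 1                                        ∎)
    where open ≡-Reasoning

  ∑χχ≡-χ : ∀ {d c} → ¬ + p ∣ℤ d → ¬ + p ∣ℤ c → ∑[ y < p ] (χ (+ y) * χ (d * + y - c)) ≡ - χ d
  ∑χχ≡-χ {d} {c} p∤d p∤c = begin
    ∑[ y < p ] (χ (+ y) * χ (d * + y - c))    ≡⟨ ∑-cong p (λ y _ → scale-by-d y) ⟩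
    ∑[ y < p ] (χ d * k (d * + y + + 0))     ≡⟨ sym (*-distribˡ-∑ p (χ d) _) ⟩
    χ d * ∑[ y < p ] k (d * + y + + 0)       ≡⟨ cong (χ d *_) (trans (∑-affine k k-cong (+ 0) p∤d) (∑χχ≡-1 p∤c)) ⟩
    χ d * - + 1                              ≡⟨ trans (ℤ.*-comm (χ d) (- + 1)) (ℤ.-1*i≡-i (χ d)) ⟩
    - χ d                                    ∎
    where
    open ≡-Reasoning
    k : ℤ → ℤ
    k w = χ w * χ (+ 1 * w - c)
    k-cong : ∀ x y → x ≡ₚ y → k x ≡ k y
    k-cong x y x≡y = cong₂ _*_ (χ-cong x y x≡y) (χ-cong _ _ (subst (+ p ∣ℤ_) (shift x y c) x≡y))
      where
      shift : ∀ x y c → x - y ≡ + 1 * x - c - (+ 1 * y - c)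
      shift = solve-∀
    scale-by-d : ∀ y → χ (+ y) * χ (d * + y - c) ≡ χ d * k (d * + y + + 0)
    scale-by-d y = sym (begin
      χ d * (χ (d * + y + + 0) * χ (+ 1 * (d * + y + + 0) - c))
        ≡⟨ cong₂ (λ a b → χ d * (χ a * χ b)) (ℤ.+-identityʳ (d * + y)) (simplify (d * + y) c) ⟩
      χ d * (χ (d * + y) * χ (d * + y - c))
        ≡⟨ cong (λ z → χ d * (z * χ (d * + y - c))) (χ-* d (+ y)) ⟩
      χ d * (χ d * χ (+ y) * χ (d * + y - c))
        ≡⟨ regroup (χ d) (χ (+ y)) (χ (d * + y - c)) ⟩
      χ d * χ d * (χ (+ y) * χ (d * + y - c))
        ≡⟨ cong (_* (χ (+ y) * χ (d * + y - c))) (χ²≡1 p∤d) ⟩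
      + 1 * (χ (+ y) * χ (d * + y - c))
        ≡⟨ ℤ.*-identityˡ _ ⟩
      χ (+ y) * χ (d * + y - c) ∎)
      where
      simplify : ∀ x c → + 1 * (x + + 0) - c ≡ x - c
      simplify = solve-∀
      regroup : ∀ a b e → a * (a * b * e) ≡ a * a * (b * e)
      regroup = solve-∀

  #solutions-mod-p : ∀ {d c} → ¬ + p ∣ℤ d → ¬ + p ∣ℤ c → #solutions p d c ≡ + p - χ d
  #solutions-mod-p {d} {c} p∤d p∤c = begin
    #solutions p d c                                   ≡⟨ #solutions≡∑#√#√ d c ⟩
    ∑[ y < p ] (#√ (+ y) * #√ (d * + y - c))           ≡⟨ ∑#√#√≡p+∑χχ c p∤d ⟩
    + p + ∑[ y < p ] (χ (+ y) * χ (d * + y - c))       ≡⟨ cong (_+_ (+ p)) (∑χχ≡-χ p∤d p∤c) ⟩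
    + p - χ d                                          ∎
    where open ≡-Reasoning

  fiber-count-∤ : ∀ m .{{_ : NonZero m}} d c x y → ¬ + m ∣ℤ 𝒩 d x y + c →
                  ∑[ s < p ] ∑[ t < p ] [ p ℕ.* m ∣ 𝒩 d (x + + m * + s) (y + + m * + t) + c ] ≡ + 0
  fiber-count-∤ m d c x y m∤N = ∑-zero p (λ s _ → ∑-zero p (λ t _ → [∣]-no (m∤N ∘ descend s t)))
    where
    descend : ∀ s t → + (p ℕ.* m) ∣ℤ 𝒩 d (x + + m * + s) (y + + m * + t) + c → + m ∣ℤ 𝒩 d x y + c
    descend s t pm∣N′ = ∣-linear (+ 1) (- (A + + m * B)) N≡N′-[A+mB]m (∣-trans (divides (+ p) (ℤ.pos-* p m)) pm∣N′) ∣-refl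
      where
      A B : ℤ
      A = + 2 * x * + s - + 2 * d * y * + t
      B = + s * + s - d * (+ t * + t)
      unshift : ∀ N c A B M → N + c ≡ + 1 * (N + M * A + M * M * B + c) + - (A + M * B) * M
      unshift = solve-∀
      N≡N′-[A+mB]m : 𝒩 d x y + c ≡ + 1 * (𝒩 d (x + + m * + s) (y + + m * + t) + c) + - (A + + m * B) * + m
      N≡N′-[A+mB]m = trans (unshift (𝒩 d x y) c A B (+ m))
        (cong (λ e → + 1 * (e + c) + - (A + + m * B) * + m) (sym (𝒩-shift d x y (+ m) (+ s) (+ t))))

  coordinate-unit : ∀ d c x y → ¬ + p ∣ℤ c → + p ∣ℤ 𝒩 d x y + c → ¬ + p ∣ℤ x ⊎ ¬ + p ∣ℤ y
  coordinate-unit d c x y p∤c p∣N with + p ∣ℤ? x | + p ∣ℤ? y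
  ... | no p∤x  | _       = inj₁ p∤x
  ... | yes _   | no p∤y  = inj₂ p∤y
  ... | yes p∣x | yes p∣y = contradiction (∣-linear (+ 1) (- + 1) (isolate-c x y d c) p∣N p∣x²-dy²) p∤c
    where
    p∣x²-dy² : + p ∣ℤ x * x + - (d * y) * y
    p∣x²-dy² = ∣m∣n⇒∣m+n (∣n⇒∣m*n x p∣x) (∣n⇒∣m*n (- (d * y)) p∣y)
    isolate-c : ∀ x y d c → c ≡ + 1 * (x * x - d * (y * y) + c) + - + 1 * (x * x + - (d * y) * y)
    isolate-c = solve-∀

  -- Writing 𝒩 d x y + c = q m, the lifted value is (q + 2xs - 2dyt) m modulo p m, which is linear in (s , t).
  fiber-count-∣ : ∀ m .{{_ : NonZero m}} d c x y → p ∣ m → ¬ + p ∣ℤ d → ¬ + p ∣ℤ c → + m ∣ℤ 𝒩 d x y + c →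
                  ∑[ s < p ] ∑[ t < p ] [ p ℕ.* m ∣ 𝒩 d (x + + m * + s) (y + + m * + t) + c ] ≡ + p
  fiber-count-∣ m d c x y (ℕ.divides m₀ m≡m₀p) p∤d p∤c (divides q N≡qm) =
    trans (∑-cong p (λ s _ → ∑-cong p (λ t _ → [∣]-cong (descend s t) (ascend s t))))
          (∑∑-linear-root-count q units)
    where
    M : ℤ
    M = + m
    G K : ℕ → ℕ → ℤ
    G s t = q + + 2 * x * + s + - (+ 2 * d * y) * + t
    K s t = + m₀ * (+ s * + s - d * (+ t * + t))
    units : ¬ + p ∣ℤ + 2 * x ⊎ ¬ + p ∣ℤ - (+ 2 * d * y)
    units with coordinate-unit d c x y p∤c (∣-trans (divides (+ m₀) (trans (cong +_ m≡m₀p) (ℤ.pos-* m₀ p))) (divides q N≡qm))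
    ... | inj₁ p∤x = inj₁ (∤-* p∤2 p∤x)
    ... | inj₂ p∤y = inj₂ (∤-neg (∤-* (∤-* p∤2 p∤d) p∤y))
    N′≡[G+pK]m : ∀ s t → 𝒩 d (x + M * + s) (y + M * + t) + c ≡ (G s t + + p * K s t) * M
    N′≡[G+pK]m s t = begin
      𝒩 d (x + M * + s) (y + M * + t) + c               ≡⟨ cong (_+ c) (𝒩-shift d x y M (+ s) (+ t)) ⟩
      𝒩 d x y + M * A + M * M * B + c                   ≡⟨ move-c (𝒩 d x y) c (M * A) (M * M * B) ⟩
      (𝒩 d x y + c) + M * A + M * M * B                 ≡⟨ cong₂ (λ N M′ → N + M * A + M * M′ * B) N≡qm
                                                                   (trans (cong +_ m≡m₀p) (ℤ.pos-* m₀ p)) ⟩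
      q * M + M * A + M * (+ m₀ * + p) * B              ≡⟨ regroup q M x d y (+ s) (+ t) (+ m₀) (+ p) ⟩
      (G s t + + p * K s t) * M                         ∎
      where
      open ≡-Reasoning
      A B : ℤ
      A = + 2 * x * + s - + 2 * d * y * + t
      B = + s * + s - d * (+ t * + t)
      move-c : ∀ N c a b → N + a + b + c ≡ N + c + a + b
      move-c = solve-∀
      regroup : ∀ q M x d y s t m₀ P → q * M + M * (+ 2 * x * s - + 2 * d * y * t) + M * (m₀ * P) * (s * s - d * (t * t))
              ≡ (q + + 2 * x * s + - (+ 2 * d * y) * t + P * (m₀ * (s * s - d * (t * t)))) * M
      regroup = solve-∀
    descend : ∀ s t → + (p ℕ.* m) ∣ℤ 𝒩 d (x + M * + s) (y + M * + t) + c → + p ∣ℤ G s t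
    descend s t pm∣N′ = ∣-linear (+ 1) (- K s t) (cancel (G s t) (+ p) (K s t)) p∣G+pK ∣-refl
      where
      p∣G+pK : + p ∣ℤ G s t + + p * K s t
      p∣G+pK = *-cancelʳ-∣ M (subst₂ _∣ℤ_ (ℤ.pos-* p m) (N′≡[G+pK]m s t) pm∣N′)
      cancel : ∀ G P K → G ≡ + 1 * (G + P * K) + - K * P
      cancel = solve-∀
    ascend : ∀ s t → + p ∣ℤ G s t → + (p ℕ.* m) ∣ℤ 𝒩 d (x + M * + s) (y + M * + t) + c
    ascend s t p∣G = subst₂ _∣ℤ_ (sym (ℤ.pos-* p m)) (sym (N′≡[G+pK]m s t))
                            (*-monoˡ-∣ M (∣m∣n⇒∣m+n p∣G (∣m⇒∣m*n (K s t) ∣-refl)))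

  fiber-count : ∀ m .{{_ : NonZero m}} d c x y → p ∣ m → ¬ + p ∣ℤ d → ¬ + p ∣ℤ c →
    ∑[ s < p ] ∑[ t < p ] [ p ℕ.* m ∣ 𝒩 d (x + + m * + s) (y + + m * + t) + c ] ≡ + p * [ m ∣ 𝒩 d x y + c ]
  fiber-count m d c x y p∣m p∤d p∤c with + m ∣ℤ? 𝒩 d x y + c
  ... | no m∤N  = trans (fiber-count-∤ m d c x y m∤N) (sym (trans (cong (+ p *_) ([∣]-no m∤N)) (ℤ.*-zeroʳ (+ p))))
  ... | yes m∣N = trans (fiber-count-∣ m d c x y p∣m p∤d p∤c m∣N)
                        (sym (trans (cong (+ p *_) ([∣]-yes m∣N)) (ℤ.*-identityʳ (+ p))))

  #solutions-lift : ∀ m .{{_ : NonZero m}} {d c} → p ∣ m → ¬ + p ∣ℤ d → ¬ + p ∣ℤ c →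
                    #solutions (p ℕ.* m) d c ≡ + p * #solutions m d c
  #solutions-lift m {d} {c} p∣m p∤d p∤c = begin
    ∑[ a < p ℕ.* m ] ∑[ b < p ℕ.* m ] [ p ℕ.* m ∣ 𝒩 d (+ a) (+ b) + c ]
      ≡⟨ ∑-blocks p m _ ⟩
    ∑[ r < m ] ∑[ s < p ] ∑[ b < p ℕ.* m ] [ p ℕ.* m ∣ 𝒩 d (+ (r ℕ.+ m ℕ.* s)) (+ b) + c ]
      ≡⟨ ∑-cong m (λ r _ → ∑-cong p (λ s _ → ∑-blocks p m _)) ⟩
    ∑[ r < m ] ∑[ s < p ] ∑[ r′ < m ] ∑[ t < p ] [ p ℕ.* m ∣ 𝒩 d (+ (r ℕ.+ m ℕ.* s)) (+ (r′ ℕ.+ m ℕ.* t)) + c ]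
      ≡⟨ ∑-cong m (λ r _ → ∑-comm p m _) ⟩
    ∑[ r < m ] ∑[ r′ < m ] ∑[ s < p ] ∑[ t < p ] [ p ℕ.* m ∣ 𝒩 d (+ (r ℕ.+ m ℕ.* s)) (+ (r′ ℕ.+ m ℕ.* t)) + c ]
      ≡⟨ ∑-cong m (λ r _ → ∑-cong m (λ r′ _ → trans (∑-cong p (λ s _ → ∑-cong p (λ t _ →
           cong₂ (λ a b → [ p ℕ.* m ∣ 𝒩 d a b + c ]) (embed r s) (embed r′ t))))
           (fiber-count m d c (+ r) (+ r′) p∣m p∤d p∤c))) ⟩
    ∑[ r < m ] ∑[ r′ < m ] (+ p * [ m ∣ 𝒩 d (+ r) (+ r′) + c ])
      ≡⟨ ∑-cong m (λ r _ → sym (*-distribˡ-∑ m (+ p) _)) ⟩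
    ∑[ r < m ] (+ p * ∑[ r′ < m ] [ m ∣ 𝒩 d (+ r) (+ r′) + c ])
      ≡⟨ sym (*-distribˡ-∑ m (+ p) _) ⟩
    + p * #solutions m d c ∎
    where
    open ≡-Reasoning
    embed : ∀ r s → + (r ℕ.+ m ℕ.* s) ≡ + r + + m * + s
    embed r s = trans (ℤ.pos-+ r (m ℕ.* s)) (cong (_+_ (+ r)) (ℤ.pos-* m s))

  #solutions-pow : ∀ k {d c} → ¬ + p ∣ℤ d → ¬ + p ∣ℤ c → #solutions (p ^ suc k) d c ≡ + (p ^ k) * #solutions p d c
  #solutions-pow zero    {d} {c} p∤d p∤c =
    trans (cong (λ n → #solutions n d c) (ℕ.*-identityʳ p)) (sym (ℤ.*-identityˡ _))
  #solutions-pow (suc k) {d} {c} p∤d p∤c = begin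
    #solutions (p ℕ.* p ^ suc k) d c      ≡⟨ #solutions-lift (p ^ suc k) {{ℕ.m^n≢0 p (suc k)}} (ℕ.m∣m*n (p ^ k)) p∤d p∤c ⟩
    + p * #solutions (p ^ suc k) d c      ≡⟨ cong (+ p *_) (#solutions-pow k p∤d p∤c) ⟩
    + p * (+ (p ^ k) * #solutions p d c)  ≡⟨ sym (ℤ.*-assoc (+ p) _ _) ⟩
    + p * + (p ^ k) * #solutions p d c    ≡⟨ cong (_* #solutions p d c) (sym (ℤ.pos-* p (p ^ k))) ⟩
    + (p ^ suc k) * #solutions p d c      ∎
    where open ≡-Reasoning

  legendre≡χ : ∀ {D} → ¬ + p ∣ℤ + D → legendre D p ≡ χ (+ D)
  legendre≡χ {D} p∤D with (D mod p) ≡ᵇ 0 in D%p≡ᵇ0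
  ... | true = contradiction (∣ᵤ⇒∣ (ℕ.m%n≡0⇒n∣m D p D%p≡0)) p∤D
    where
    D%p≡0 : D % p ≡ 0
    D%p≡0 = trans (sym (mod≡% D p)) (ℕ.≡ᵇ⇒≡ _ _ (subst T (sym D%p≡ᵇ0) _))
  ... | false with any (λ y → ((y ℕ.* y) mod p) ≡ᵇ (D mod p)) (upTo p) in has-root
  ...   | true with applyUpTo⁻ (λ i → i) (any⁻ _ (upTo p) (subst T (sym has-root) _))
  ...     | y , _ , yy≡D = sym (χ-square p∤D (+ y , subst (λ z → + p ∣ℤ z - + D) (ℤ.pos-* y y)
                                  (Equivalence.to (mod-≡⇔∣ p (y ℕ.* y) D) (ℕ.≡ᵇ⇒≡ _ _ yy≡D))))
  legendre≡χ {D} p∤D | false | false = sym (χ-nonsquare nonsquare)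
    where
    nonsquare : ¬ IsSquare (+ D)
    nonsquare D-square with residue-square D-square
    ... | a , a<p , aa≡D = subst T has-root (any⁺ _ (applyUpTo⁺ (λ i → i) root a<p))
      where
      root : T (((a ℕ.* a) mod p) ≡ᵇ (D mod p))
      root = ℕ.≡⇒≡ᵇ _ _ (Equivalence.from (mod-≡⇔∣ p (a ℕ.* a) D)
                          (subst (λ z → + p ∣ℤ z - + D) (sym (ℤ.pos-* a a)) aa≡D))

dimV≡#solutions : ∀ M .{{_ : NonZero M}} D C → + dimV M D C ≡ #solutions M (+ D) (+ C)
dimV≡#solutions M D C = begin
  + length (filter _ (cartesianProduct (upTo M) (upTo M)))
    ≡⟨ length-filter _ (pairs M) ⟩
  ∑ˡ (cartesianProduct (upTo M) (upTo M)) _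
    ≡⟨ ∑ˡ-cartesianProduct (upTo M) (upTo M) _ ⟩
  ∑ˡ (upTo M) (λ a → ∑ˡ (upTo M) (λ b → 𝟙 (((a ℕ.* a ℕ.+ C) mod M) ℕ.≟ ((D ℕ.* b ℕ.* b) mod M))))
    ≡⟨ trans (∑ˡ-applyUpTo M (λ i → i) _)
             (∑-cong M (λ a _ → trans (∑ˡ-applyUpTo M (λ i → i) _) (∑-cong M (λ b _ → same-test a b)))) ⟩
  #solutions M (+ D) (+ C) ∎
  where
  open ≡-Reasoning
  embed : ∀ a b → + (a ℕ.* a ℕ.+ C) - + (D ℕ.* b ℕ.* b) ≡ 𝒩 (+ D) (+ a) (+ b) + + C
  embed a b = trans (cong₂ _-_ (trans (ℤ.pos-+ (a ℕ.* a) C) (cong (_+ + C) (ℤ.pos-* a a)))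
                                (trans (ℤ.pos-* (D ℕ.* b) b) (cong (_* + b) (ℤ.pos-* D b))))
                    (rearrange (+ a) (+ b) (+ C) (+ D))
    where
    rearrange : ∀ a b c d → a * a + c - d * b * b ≡ a * a - d * (b * b) + c
    rearrange = solve-∀
  same-test : ∀ a b → 𝟙 (((a ℕ.* a ℕ.+ C) mod M) ℕ.≟ ((D ℕ.* b ℕ.* b) mod M)) ≡ [ M ∣ 𝒩 (+ D) (+ a) (+ b) + + C ]
  same-test a b with ((a ℕ.* a ℕ.+ C) mod M) ℕ.≟ ((D ℕ.* b ℕ.* b) mod M)
  ... | yes e = sym ([∣]-yes (subst (+ M ∣ℤ_) (embed a b) (Equivalence.to (mod-≡⇔∣ M _ _) e)))
  ... | no ¬e = sym ([∣]-no (¬e ∘ Equivalence.from (mod-≡⇔∣ M _ _) ∘ subst (+ M ∣ℤ_) (sym (embed a b))))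

mainTheorem9 : (p k D C : ℕ) → Prime p → 3 < p → 1 ≤ k →
    D < p ^ (2 Data.Nat.* k) → C < p ^ k → ¬ (p ∣ C) → ¬ (p ∣ D) →
    + dimV (p ^ k) D C ≡ + (p ^ k) - legendre D p * + (p ^ (k ∸ 1))
mainTheorem9 p@(suc _) (suc k) D C p-prime 3<p _ _ _ p∤C p∤D = begin
  + dimV (p ^ suc k) D C                    ≡⟨ dimV≡#solutions (p ^ suc k) {{ℕ.m^n≢0 p (suc k)}} D C ⟩
  #solutions (p ^ suc k) (+ D) (+ C)        ≡⟨ #solutions-pow k p∤ℤD p∤ℤC ⟩
  + (p ^ k) * #solutions p (+ D) (+ C)      ≡⟨ cong (+ (p ^ k) *_) (#solutions-mod-p p∤ℤD p∤ℤC) ⟩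
  + (p ^ k) * (+ p - χ (+ D))               ≡⟨ distribute (+ p) (+ (p ^ k)) (χ (+ D)) ⟩
  + p * + (p ^ k) - χ (+ D) * + (p ^ k)     ≡⟨ cong₂ (λ a b → a - b * + (p ^ k)) (sym (ℤ.pos-* p (p ^ k)))
                                                                              (sym (legendre≡χ p∤ℤD)) ⟩
  + (p ^ suc k) - legendre D p * + (p ^ k)  ∎
  where
  open ≡-Reasoning
  p∤2 : ¬ + p ∣ℤ + 2
  p∤2 p∣2 = ℕ.<⇒≱ 3<p (ℕ.≤-trans (ℕ.∣⇒≤ (∣⇒∣ᵤ p∣2)) (ℕ.n≤1+n 2))
  open OddModulo p p-prime p∤2 using (χ; #solutions-mod-p; #solutions-pow; legendre≡χ)
  p∤ℤD : ¬ + p ∣ℤ + D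
  p∤ℤD = p∤D ∘ ∣⇒∣ᵤ
  p∤ℤC : ¬ + p ∣ℤ + C
  p∤ℤC = p∤C ∘ ∣⇒∣ᵤ
  distribute : ∀ a b x → b * (a - x) ≡ a * b - x * b
  distribute = solve-∀
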